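{- Let $P$ be a metric ray of an infinite graph $G$ with ordered vertex set $V(P)=\{u_0,u_1,u_2,\dots\}$, and let $S=\{x_1,\dots,x_n\}$ be a finite set of vertices of $G$. Then there exists an integer $i_0\ge 0$ such that for every $k\ge 0$, $$r(u_{i_0+k}\mid S)=r(u_{i_0}\mid S)+(k,\dots,k),$$ where $(k,\dots,k)$ has $|S|$ entries.
   Context: All graphs are simple, connected and locally finite. $d_G$ is the shortest-path distance. For a finite ordered set $S=\{x_1,\dots,x_n\}$ of vertices, $r(u\mid S)=(d(u,x_1),\dots,d(u,x_n))$. A metric ray with endpoint $u_0$ in $G$ is a subgraph $P$ of $G$ isomorphic to the one-way infinite path, with an ordering $V(P)=\{u_0,u_1,u_2,\dots\}$ such that $u_k$ is adjacent to $u_{k+1}$ in $P$ for all $k\ge 0$ and $d_G(u_0,u_k)=d_P(u_0,u_k)=k$ for all $k$. -}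

module Defs where

open import Data.Nat using (ℕ; zero; suc; _+_; _≤_)
open import Data.Fin using (Fin)
open import Data.List using (List)
open import Data.List.Membership.Propositional using (_∈_)
open import Data.Product using (Σ; ∃; _×_; _,_)
open import Function.Bundles using (_⇔_)
open import Relation.Nullary using (¬_)

data Walk {V : Set} (_~_ : V → V → Set) : V → V → ℕ → Set where
  here : ∀ {u} → Walk _~_ u u zero
  step : ∀ {u w v n} → u ~ w → Walk _~_ w v n → Walk _~_ u v (suc n)

record Graph : Set₁ where
  field
    V     : Set
    _~_   : V → V → Set
    ~-sym : ∀ {x y} → x ~ y → y ~ x
    ~-irr : ∀ {x} → ¬ (x ~ x)
    connected     : ∀ u v → ∃ λ n → Walk _~_ u v n
    locallyFinite : ∀ v → Σ (List V) λ ns → ∀ w → (w ~ v) ⇔ (w ∈ ns)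

  IsDist : V → V → ℕ → Set
  IsDist u v n = Walk _~_ u v n × (∀ m → Walk _~_ u v m → n ≤ m)

open Graph public

Infinite : Graph → Set
Infinite G = ¬ (Σ (List (V G)) λ l → ∀ v → v ∈ l)

record MetricRay (G : Graph) (u : ℕ → V G) : Set where
  field
    adjacent : ∀ k → _~_ G (u k) (u (suc k))
    geodesic : ∀ k → IsDist G (u 0) (u k) k

-- r(v | S) = r  : r is the distance vector of v to x₁,…,xₙ
IsRep : (G : Graph) {n : ℕ} → V G → (Fin n → V G) → (Fin n → ℕ) → Set
IsRep G v S r = ∀ j → IsDist G v (S j) (r j)

module Submission where

-- Fix a target vertex x and put f(i) = d(u_i, x).  Two
-- triangle inequalities control f: since u_i and u_{i+1} are adjacent,
-- f(i+1) ≤ f(i) + 1; since the ray is geodesic, i = d(u_0, u_i) ≤ f(0) + f(i).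
-- These two facts alone force f to have slope exactly one from some point on:
-- the "excess" f(0) + f(i) - i is a natural number, it never increases, and
-- it strictly drops whenever f falls below slope one; so by well-founded
-- induction on the excess we reach an index after which f(i+k) = f(i) + k.
-- Such indices are closed upwards, so finitely many targets x_1,…,x_n have a
-- common one, which is the i₀ of the theorem.

open import Defs
open import Axiom.ExcludedMiddle using (ExcludedMiddle)
open import Level using (0ℓ)
open import Data.Nat using (ℕ; zero; suc; _+_; _∸_; _≤_; _<_; s≤s)
open import Data.Nat.Properties
open import Data.Nat.Induction using (<-rec)
open import Data.Fin using (Fin) renaming (zero to fzero; suc to fsuc)
open import Data.Product using (Σ; _×_; _,_; proj₁; proj₂)
open import Relation.Binary.PropositionalEquality
open import Relation.Nullary using (¬_; yes; no)

module _ {A : Set} {_~_ : A → A → Set} where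

  _++ᵂ_ : ∀ {a b c m n} → Walk _~_ a b m → Walk _~_ b c n → Walk _~_ a c (m + n)
  here     ++ᵂ q = q
  step e p ++ᵂ q = step e (p ++ᵂ q)

  snocᵂ : ∀ {a b c m} → Walk _~_ a b m → b ~ c → Walk _~_ a c (suc m)
  snocᵂ {m = m} p e = subst (Walk _~_ _ _) (+-comm m 1) (p ++ᵂ step e here)

  reverseᵂ : (∀ {a b} → a ~ b → b ~ a) →
             ∀ {a b m} → Walk _~_ a b m → Walk _~_ b a m
  reverseᵂ sym~ here       = here
  reverseᵂ sym~ (step e p) = snocᵂ (reverseᵂ sym~ p) (sym~ e)

SlopeOneFrom : (ℕ → ℕ) → ℕ → Set
SlopeOneFrom f i = ∀ k → f (i + k) ≡ f i + k

slopeOne-mono : ∀ f i m → SlopeOneFrom f i → SlopeOneFrom f (i + m)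
slopeOne-mono f i m slope k = begin
  f (i + m + k)     ≡⟨ cong f (+-assoc i m k) ⟩
  f (i + (m + k))   ≡⟨ slope (m + k) ⟩
  f i + (m + k)     ≡⟨ sym (+-assoc (f i) m k) ⟩
  f i + m + k       ≡⟨ cong (_+ k) (sym (slope m)) ⟩
  f (i + m) + k     ∎
  where open ≡-Reasoning

module EventuallySlopeOne
  (em : ExcludedMiddle 0ℓ) (f : ℕ → ℕ)
  (grows-≤-one : ∀ i → f (suc i) ≤ suc (f i))
  (C : ℕ) (above-line : ∀ i → i ≤ C + f i) where

  steps-≤ : ∀ i k → f (i + k) ≤ f i + k
  steps-≤ i zero    = ≤-reflexive (trans (cong f (+-identityʳ i)) (sym (+-identityʳ (f i))))
  steps-≤ i (suc k) = begin
    f (i + suc k)     ≡⟨ cong f (+-suc i k) ⟩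
    f (suc (i + k))   ≤⟨ grows-≤-one (i + k) ⟩
    suc (f (i + k))   ≤⟨ s≤s (steps-≤ i k) ⟩
    suc (f i + k)     ≡⟨ sym (+-suc (f i) k) ⟩
    f i + suc k       ∎
    where open ≤-Reasoning

  excess : ℕ → ℕ
  excess i = (C + f i) ∸ i

  excess-spec : ∀ i → C + f i ≡ i + excess i
  excess-spec i = sym (m+[n∸m]≡n (above-line i))

  excess-drops : ∀ i k → f (i + k) < f i + k → excess (i + k) < excess i
  excess-drops i k drop = +-cancelˡ-< (i + k) _ _ (begin-strict
    i + k + excess (i + k)  ≡⟨ sym (excess-spec (i + k)) ⟩
    C + f (i + k)           <⟨ +-monoʳ-< C drop ⟩
    C + (f i + k)           ≡⟨ sym (+-assoc C (f i) k) ⟩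
    C + f i + k             ≡⟨ cong (_+ k) (excess-spec i) ⟩
    i + excess i + k        ≡⟨ +-assoc i (excess i) k ⟩
    i + (excess i + k)      ≡⟨ cong (i +_) (+-comm (excess i) k) ⟩
    i + (k + excess i)      ≡⟨ sym (+-assoc i k (excess i)) ⟩
    i + k + excess i        ∎)
    where open ≤-Reasoning

  no-drop⇒slopeOne : ∀ i → ¬ (Σ ℕ λ k → f (i + k) < f i + k) → SlopeOneFrom f i
  no-drop⇒slopeOne i no-drop k =
    ≤-antisym (steps-≤ i k) (≮⇒≥ (λ drop → no-drop (k , drop)))

  slopeOne-beyond : ∀ i → Σ ℕ λ m → SlopeOneFrom f (i + m)
  slopeOne-beyond i = <-rec Motive induct (excess i) i refl
    where
    Motive : ℕ → Set
    Motive c = ∀ i → excess i ≡ c → Σ ℕ λ m → SlopeOneFrom f (i + m)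

    induct : ∀ c → (∀ {c′} → c′ < c → Motive c′) → Motive c
    induct c ih i refl with em {Σ ℕ λ k → f (i + k) < f i + k}
    ... | no no-drop =
      0 , subst (SlopeOneFrom f) (sym (+-identityʳ i)) (no-drop⇒slopeOne i no-drop)
    ... | yes (k , drop) =
      let (m , slope) = ih (excess-drops i k drop) (i + k) refl
      in k + m , subst (SlopeOneFrom f) (+-assoc i k m) slope

commonSlopeOne : ∀ n (f : Fin n → ℕ → ℕ) →
  (∀ j i → Σ ℕ λ m → SlopeOneFrom (f j) (i + m)) →
  ∀ i → Σ ℕ λ m → ∀ j → SlopeOneFrom (f j) (i + m)
commonSlopeOne zero    f beyond i = 0 , λ ()
commonSlopeOne (suc n) f beyond i
  with commonSlopeOne n (λ j → f (fsuc j)) (λ j → beyond (fsuc j)) i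
... | m₁ , slope-rest with beyond fzero (i + m₁)
... | m₂ , slope-first = m₁ + m₂ , together
  where
  together : ∀ j → SlopeOneFrom (f j) (i + (m₁ + m₂))
  together fzero    = subst (SlopeOneFrom (f fzero)) (+-assoc i m₁ m₂) slope-first
  together (fsuc j) = subst (SlopeOneFrom (f (fsuc j))) (+-assoc i m₁ m₂)
                        (slopeOne-mono (f (fsuc j)) (i + m₁) m₂ (slope-rest j))

module Distance (em : ExcludedMiddle 0ℓ) (G : Graph) where
  open Graph G using () renaming (_~_ to Edge; ~-sym to Edge-sym)

  shortest : ∀ {a b} N → Walk Edge a b N → Σ ℕ λ m → IsDist G a b m
  shortest {a} {b} = <-rec Motive induct
    where
    Motive : ℕ → Set
    Motive N = Walk Edge a b N → Σ ℕ λ m → IsDist G a b m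

    induct : ∀ N → (∀ {N′} → N′ < N → Motive N′) → Motive N
    induct N ih w with em {Σ ℕ λ m → m < N × Walk Edge a b m}
    ... | yes (m , m<N , w′) = ih m<N w′
    ... | no no-shorter = N , w , λ m w′ → ≮⇒≥ (λ m<N → no-shorter (m , m<N , w′))

  distance : ∀ a b → Σ ℕ λ m → IsDist G a b m
  distance a b = shortest _ (proj₂ (connected G a b))

  triangle : ∀ {a b c p q r} → Walk Edge a b p → IsDist G b c q → IsDist G a c r → r ≤ p + q
  triangle p (q , _) (_ , minimal) = minimal _ (p ++ᵂ q)

  IsDist-sym : ∀ {a b m} → IsDist G a b m → IsDist G b a m
  IsDist-sym (w , minimal) = reverseᵂ Edge-sym w , λ m w′ → minimal m (reverseᵂ Edge-sym w′)

module RayDistance (em : ExcludedMiddle 0ℓ) (G : Graph)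
                   (u : ℕ → V G) (ray : MetricRay G u) (x : V G) where
  open Graph G using () renaming (~-sym to Edge-sym)
  open MetricRay ray
  open Distance em G

  f : ℕ → ℕ
  f i = proj₁ (distance (u i) x)

  f-spec : ∀ i → IsDist G (u i) x (f i)
  f-spec i = proj₂ (distance (u i) x)

  f-step : ∀ i → f (suc i) ≤ suc (f i)
  f-step i = triangle (step (Edge-sym (adjacent i)) here) (f-spec i) (f-spec (suc i))

  f-above-line : ∀ i → i ≤ f 0 + f i
  f-above-line i = triangle (proj₁ (f-spec 0)) (IsDist-sym (f-spec i)) (geodesic i)

  slopeOne-beyond : ∀ i → Σ ℕ λ m → SlopeOneFrom f (i + m)
  slopeOne-beyond = EventuallySlopeOne.slopeOne-beyond em f f-step (f 0) f-above-line

lemma4 : ExcludedMiddle 0ℓ → (G : Graph) → Infinite G →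
    (u : ℕ → V G) → MetricRay G u →
    (n : ℕ) (S : Fin n → V G) →
    Σ ℕ λ i₀ → Σ (Fin n → ℕ) λ r₀ →
    IsRep G (u i₀) S r₀ ×
    (∀ k → IsRep G (u (i₀ + k)) S (λ j → r₀ j + k))
lemma4 em G _ u ray n S = i₀ , (λ j → dist j i₀) , (λ j → dist-spec j i₀) , shifted
  where
  dist : Fin n → ℕ → ℕ
  dist j = RayDistance.f em G u ray (S j)

  dist-spec : ∀ j i → IsDist G (u i) (S j) (dist j i)
  dist-spec j = RayDistance.f-spec em G u ray (S j)

  common : Σ ℕ λ m → ∀ j → SlopeOneFrom (dist j) (0 + m)
  common = commonSlopeOne n dist (λ j → RayDistance.slopeOne-beyond em G u ray (S j)) 0

  i₀ : ℕ
  i₀ = proj₁ common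

  shifted : ∀ k → IsRep G (u (i₀ + k)) S (λ j → dist j i₀ + k)
  shifted k j = subst (IsDist G (u (i₀ + k)) (S j)) (proj₂ common j k) (dist-spec j (i₀ + k))
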